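{- $\mathrm{WEAC}\neq\mathrm{EAC}$.
   Context: Consider online problems (in the tape-advice model, where an all-powerful oracle seeing the whole input writes an advice string that the online algorithm may read, and the advice complexity is the number of advice bits read) whose inputs consist of $n$ items; let $s$ denote the maximum bit size of an input item. The class EAC (efficient advice complexity) consists of those online problems $P$ such that for every $\epsilon>0$, competitive ratio $1+\epsilon$ for $P$ can be achieved with advice complexity $O_\epsilon(\mathrm{poly}(\log n))$. The class WEAC (weakly efficient advice complexity) consists of those online problems $P$ such that for every $\epsilon>0$, competitive ratio $1+\epsilon$ can be achieved with advice complexity $O_\epsilon(\mathrm{poly}(\log n, s))$; thus EAC $\subseteq$ WEAC. An online algorithm for a maximization problem has competitive ratio $c$ if there is a constant $\alpha$ with $\mathrm{OPT}(I)\le c\,\mathrm{ALG}(I)+\alpha$ for all inputs $I$. -}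

module Defs where

open import Data.Bool using (Bool)
open import Data.Nat as ℕ using (ℕ; zero; suc; _⊔_; _^_)
open import Data.Nat.Logarithm using (⌊log₂_⌋)
open import Data.List using (List; []; _∷_; [_]; _++_; length; map; upTo; foldr)
open import Data.Product using (Σ; ∃; ∃-syntax; _×_; _,_; proj₁; proj₂)
open import Data.Rational using (ℚ; 0ℚ; 1ℚ; _+_; _*_; _≤_; _<_)
open import Level using (0ℓ)

Item : Set
Item = List Bool

Input : Set
Input = List Item

size : Input → ℕ
size = length

maxItemBits : Input → ℕ
maxItemBits = foldr (λ x m → length x ⊔ m) 0

data Goal : Set where
  maximization minimization : Goal

record OnlineProblem : Set₁ where
  field
    goal     : Goal
    Output   : Set
    Feasible : Input → List Output → Set
    value    : Input → List Output → ℚ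
open OnlineProblem public

-- Adaptive reading from the advice tape: a finite query tree that reads
-- the next tape bit(s) one at a time before producing a result.

data Reader (A : Set) : Set where
  done : A → Reader A
  read : (Bool → Reader A) → Reader A

Tape : Set
Tape = ℕ → Bool

runReader : {A : Set} → Reader A → Tape → ℕ → A × ℕ
runReader (done a) φ p = a , p
runReader (read k) φ p = runReader (k (φ p)) φ (suc p)

record AdviceAlgorithm (P : OnlineProblem) : Set where
  field
    step : (previous : Input) → (current : Item) → (bitsReadSoFar : List Bool)
         → Reader (Output P)
open AdviceAlgorithm public

process : {P : OnlineProblem} → AdviceAlgorithm P → Tape
        → (previous : Input) → (pos : ℕ) → (remaining : Input)
        → List (Output P) × ℕ
process A φ prev p [] = [] , p
process A φ prev p (x ∷ xs) =
  let r    = runReader (step A prev x (map φ (upTo p))) φ p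
      rest = process A φ (prev ++ [ x ]) (proj₂ r) xs
  in (proj₁ r ∷ proj₁ rest) , proj₂ rest

runAlg : {P : OnlineProblem} → AdviceAlgorithm P → Tape → Input → List (Output P)
runAlg A φ I = proj₁ (process A φ [] 0 I)

bitsRead : {P : OnlineProblem} → AdviceAlgorithm P → Tape → Input → ℕ
bitsRead A φ I = proj₂ (process A φ [] 0 I)

-- Competitiveness of one run against every feasible solution (i.e. against OPT):
--   maximization:  OPT(I) ≤ c·ALG(I) + α
--   minimization:  ALG(I) ≤ c·OPT(I) + α

CompetitiveOn : (P : OnlineProblem) → Goal → (c α : ℚ) → Input → List (Output P) → Set
CompetitiveOn P maximization c α I out =
  ∀ (y : List (Output P)) → Feasible P I y → value P I y ≤ c * value P I out + α
CompetitiveOn P minimization c α I out =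
  ∀ (y : List (Output P)) → Feasible P I y → value P I out ≤ c * value P I y + α

AchievesWithAdvice : (P : OnlineProblem) → (c : ℚ) → (b : ℕ → ℕ → ℕ) → Set
AchievesWithAdvice P c b =
  Σ (AdviceAlgorithm P) λ A → Σ ℚ λ α → ∀ (I : Input) → Σ Tape λ φ →
      (bitsRead A φ I ℕ.≤ b (size I) (maxItemBits I))
    × Feasible P I (runAlg A φ I)
    × CompetitiveOn P (goal P) c α I (runAlg A φ I)

-- EAC: for every ε > 0, ratio 1+ε with advice O_ε(poly(log n)),
-- i.e. at most C·(1 + ⌊log₂ n⌋)^k bits for constants C, k depending on ε.
InEAC : OnlineProblem → Set
InEAC P = ∀ (ε : ℚ) → 0ℚ < ε → ∃[ C ] ∃[ k ]
  AchievesWithAdvice P (1ℚ + ε) (λ n s → C ℕ.* ((1 ℕ.+ ⌊log₂ n ⌋) ^ k))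

-- WEAC: for every ε > 0, ratio 1+ε with advice O_ε(poly(log n, s)),
-- i.e. at most C·(1 + ⌊log₂ n⌋ + s)^k bits for constants C, k depending on ε.
InWEAC : OnlineProblem → Set
InWEAC P = ∀ (ε : ℚ) → 0ℚ < ε → ∃[ C ] ∃[ k ]
  AchievesWithAdvice P (1ℚ + ε) (λ n s → C ℕ.* ((1 ℕ.+ ⌊log₂ n ⌋ ℕ.+ s) ^ k))

-- The separating problem: on input a, b, … the first answer scores |a| if it equals |b| ≤ |a|,
-- and nothing otherwise.  Since s ≥ |a|, writing |b| in unary on the tape costs at most s
-- bits and yields the optimum, so the problem is in WEAC.  On two-item inputs n = 2, so an
-- EAC algorithm reads at most a constant B bits there, and its first answer, which is computed
-- before b is seen, ranges over at most 2^B values.  Taking |a| = L > 2^B + |α|, some length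
-- t ≤ L is never guessed; on the input a, 1^t the algorithm scores 0 while OPT = L > α.
module Submission where

open import Defs
open import Data.Bool using (Bool; true; false; T)
open import Data.Fin as Fin using (Fin; toℕ)
import Data.Fin.Properties as FinP
open import Data.Integer as ℤ using (+_)
import Data.Integer.Properties as ℤP
open import Data.List using (List; []; _∷_; [_]; _++_; length; map; upTo; replicate; lookup)
import Data.List.Properties as ListP
open import Data.List.Membership.Propositional using (_∈_)
open import Data.List.Membership.Propositional.Properties using (∈-++⁺ˡ; ∈-++⁺ʳ)
open import Data.List.Relation.Unary.Any using (here; index)
open import Data.List.Relation.Unary.Any.Properties using (lookup-index)
open import Data.Nat as ℕ using (ℕ; zero; suc; _<ᵇ_; _^_; z≤n; s≤s)
import Data.Nat.Coprimality as Coprimality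
open import Data.Nat.Logarithm using (⌊log₂_⌋)
import Data.Nat.Properties as ℕP
open import Data.Product using (Σ; _×_; _,_; proj₁; proj₂; ∃-syntax)
open import Data.Rational using (ℚ; mkℚ; ↥_; 0ℚ; 1ℚ; _+_; _*_; _≤_; *≤*; nonNegative)
import Data.Rational.Properties as ℚP
open import Data.Unit using (⊤; tt)
open import Relation.Nullary using (¬_; Dec; yes; no; contradiction)
open import Relation.Binary.PropositionalEquality using (_≡_; _≢_; refl; sym; trans; cong; subst; subst₂)

runReader-advances : ∀ {A : Set} (r : Reader A) φ p → p ℕ.≤ proj₂ (runReader r φ p)
runReader-advances (done a) φ p = ℕP.≤-refl
runReader-advances (read k) φ p = ℕP.≤-trans (ℕP.n≤1+n p) (runReader-advances (k (φ p)) φ (suc p))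

process-advances : ∀ {P} (A : AdviceAlgorithm P) φ prev p xs → p ℕ.≤ proj₂ (process A φ prev p xs)
process-advances A φ prev p [] = ℕP.≤-refl
process-advances A φ prev p (x ∷ xs) =
  ℕP.≤-trans (runReader-advances (step A prev x (map φ (upTo p))) φ p)
             (process-advances A φ (prev ++ [ x ]) _ xs)

outcomes : {A : Set} → Reader A → ℕ → List A
outcomes (done a) _       = [ a ]
outcomes (read k) zero    = []
outcomes (read k) (suc B) = outcomes (k true) B ++ outcomes (k false) B

length-outcomes : ∀ {A : Set} (r : Reader A) B → length (outcomes r B) ℕ.≤ 2 ^ B
length-outcomes (done a) B       = ℕP.m^n>0 2 B
length-outcomes (read k) zero    = z≤n
length-outcomes (read k) (suc B) = begin
  length (outcomes (k true) B ++ outcomes (k false) B)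
    ≡⟨ ListP.length-++ (outcomes (k true) B) ⟩
  length (outcomes (k true) B) ℕ.+ length (outcomes (k false) B)
    ≤⟨ ℕP.+-mono-≤ (length-outcomes (k true) B) (length-outcomes (k false) B) ⟩
  2 ^ B ℕ.+ 2 ^ B
    ≡⟨ cong (2 ^ B ℕ.+_) (sym (ℕP.+-identityʳ (2 ^ B))) ⟩
  2 ^ suc B ∎
  where open ℕP.≤-Reasoning

runReader-∈-outcomes : ∀ {A : Set} (r : Reader A) φ p B →
  proj₂ (runReader r φ p) ℕ.≤ p ℕ.+ B → proj₁ (runReader r φ p) ∈ outcomes r B
runReader-∈-outcomes (done a) φ p B _ = here refl
runReader-∈-outcomes (read k) φ p zero bound =
  contradiction (ℕP.≤-trans (runReader-advances (k (φ p)) φ (suc p))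
                            (ℕP.≤-trans bound (ℕP.≤-reflexive (ℕP.+-identityʳ p))))
                (ℕP.<-irrefl refl)
runReader-∈-outcomes (read k) φ p (suc B) bound with φ p
... | true  = ∈-++⁺ˡ (runReader-∈-outcomes (k true) φ (suc p) B bound′)
  where bound′ = ℕP.≤-trans bound (ℕP.≤-reflexive (ℕP.+-suc p B))
... | false = ∈-++⁺ʳ (outcomes (k true) B) (runReader-∈-outcomes (k false) φ (suc p) B bound′)
  where bound′ = ℕP.≤-trans bound (ℕP.≤-reflexive (ℕP.+-suc p B))

cover⇒<length : ∀ {L} {xs : List ℕ} → (∀ t → t ℕ.≤ L → t ∈ xs) → L ℕ.< length xs
cover⇒<length {L} {xs} cover =
  ℕP.≰⇒> λ len≤L → collision (FinP.pigeonhole (s≤s len≤L) position)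
  where
  bounded : (i : Fin (suc L)) → toℕ i ℕ.≤ L
  bounded i = ℕP.≤-pred (FinP.toℕ<n i)
  position : Fin (suc L) → Fin (length xs)
  position i = index (cover (toℕ i) (bounded i))
  valueAt : ∀ i → toℕ i ≡ lookup xs (position i)
  valueAt i = lookup-index (cover (toℕ i) (bounded i))
  collision : ¬ (∃[ i ] ∃[ j ] (i Fin.< j × position i ≡ position j))
  collision (i , j , i<j , same) =
    ℕP.<-irrefl (trans (valueAt i) (trans (cong (lookup xs) same) (sym (valueAt j)))) i<j

fromℕ : ℕ → ℚ
fromℕ n = mkℚ (+ n) 0 (Coprimality.sym (Coprimality.1-coprimeTo n))

0≤fromℕ : ∀ n → 0ℚ ≤ fromℕ n
0≤fromℕ n = *≤* (subst (ℤ._≤_ (+ 0)) (sym (ℤP.*-identityʳ (+ n))) (ℤ.+≤+ z≤n))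

fromℕ≤⇒≤∣↥∣ : ∀ {n} α → fromℕ n ≤ α → n ℕ.≤ ℤ.∣ ↥ α ∣
fromℕ≤⇒≤∣↥∣ {n} (mkℚ k d _) (*≤* le) = bound k cross-multiplied
  where
  cross-multiplied : + (n ℕ.* suc d) ℤ.≤ k
  cross-multiplied = subst₂ ℤ._≤_ (sym (ℤP.pos-* n (suc d))) (ℤP.*-identityʳ k) le
  bound : ∀ k → + (n ℕ.* suc d) ℤ.≤ k → n ℕ.≤ ℤ.∣ k ∣
  bound (+ m) (ℤ.+≤+ nd≤m) = ℕP.≤-trans (ℕP.m≤m*n n (suc d)) nd≤m

≤-scaleUp : ∀ {ε w} → 0ℚ ≤ ε → 0ℚ ≤ w → w ≤ (1ℚ + ε) * w + 0ℚ
≤-scaleUp {ε} {w} 0≤ε 0≤w = begin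
  w                  ≡⟨ sym (ℚP.*-identityˡ w) ⟩
  1ℚ * w             ≤⟨ ℚP.*-monoʳ-≤-nonNeg w {{nonNegative 0≤w}} 1≤1+ε ⟩
  (1ℚ + ε) * w       ≡⟨ sym (ℚP.+-identityʳ _) ⟩
  (1ℚ + ε) * w + 0ℚ  ∎
  where
  open ℚP.≤-Reasoning
  1≤1+ε : 1ℚ ≤ 1ℚ + ε
  1≤1+ε = subst (_≤ 1ℚ + ε) (ℚP.+-identityʳ 1ℚ) (ℚP.+-monoʳ-≤ 1ℚ 0≤ε)

guessValue : Input → List ℕ → ℚ
guessValue (a ∷ b ∷ _) (o ∷ _) with length b ℕP.≤? length a | o ℕP.≟ length b
... | yes _ | yes _ = fromℕ (length a)
... | _     | _     = 0ℚ
guessValue _ _ = 0ℚ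

LengthGuessing : OnlineProblem
LengthGuessing = record
  { goal     = maximization
  ; Output   = ℕ
  ; Feasible = λ _ _ → ⊤
  ; value    = guessValue
  }

guessValue-hit : ∀ a b rest os → length b ℕ.≤ length a →
  guessValue (a ∷ b ∷ rest) (length b ∷ os) ≡ fromℕ (length a)
guessValue-hit a b rest os b≤a with length b ℕP.≤? length a | length b ℕP.≟ length b
... | yes _   | yes _ = refl
... | no  b≰a | _     = contradiction b≤a b≰a
... | yes _   | no  ≢ = contradiction refl ≢

guessValue-miss : ∀ a b rest o os → o ≢ length b → guessValue (a ∷ b ∷ rest) (o ∷ os) ≡ 0ℚ
guessValue-miss a b rest o os o≢b with length b ℕP.≤? length a | o ℕP.≟ length b
... | yes _ | yes o≡b = contradiction o≡b o≢b
... | yes _ | no  _   = refl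
... | no  _ | _       = refl

guessValue≤fromℕ : ∀ a b rest y → guessValue (a ∷ b ∷ rest) y ≤ fromℕ (length a)
guessValue≤fromℕ a b rest []      = 0≤fromℕ (length a)
guessValue≤fromℕ a b rest (o ∷ _) with length b ℕP.≤? length a | o ℕP.≟ length b
... | yes _ | yes _ = ℚP.≤-refl
... | yes _ | no  _ = 0≤fromℕ (length a)
... | no  _ | _     = 0≤fromℕ (length a)

guessValue-tooLong : ∀ a b rest y → ¬ length b ℕ.≤ length a → guessValue (a ∷ b ∷ rest) y ≡ 0ℚ
guessValue-tooLong a b rest []      b≰a = refl
guessValue-tooLong a b rest (o ∷ _) b≰a with length b ℕP.≤? length a | o ℕP.≟ length b
... | yes b≤a | _ = contradiction b≤a b≰a
... | no  _   | _ = refl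

0≤guessValue : ∀ I y → 0ℚ ≤ guessValue I y
0≤guessValue (a ∷ b ∷ _) (o ∷ _) with length b ℕP.≤? length a | o ℕP.≟ length b
... | yes _ | yes _ = 0≤fromℕ (length a)
... | yes _ | no  _ = ℚP.≤-refl
... | no  _ | _     = ℚP.≤-refl
0≤guessValue []          _       = ℚP.≤-refl
0≤guessValue (_ ∷ [])    _       = ℚP.≤-refl
0≤guessValue (_ ∷ _ ∷ _) []      = ℚP.≤-refl

readUnary : ℕ → ℕ → Reader ℕ
readUnary count zero    = done count
readUnary count (suc m) = read λ { true → readUnary (suc count) m ; false → done count }

unaryTape : ℕ → Tape
unaryTape t i = i <ᵇ t

readUnary-reads≤ : ∀ φ count m p → proj₂ (runReader (readUnary count m) φ p) ℕ.≤ p ℕ.+ m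
readUnary-reads≤ φ count zero    p = ℕP.≤-reflexive (sym (ℕP.+-identityʳ p))
readUnary-reads≤ φ count (suc m) p with φ p
... | true  = ℕP.≤-trans (readUnary-reads≤ φ (suc count) m (suc p)) (ℕP.≤-reflexive (sym (ℕP.+-suc p m)))
... | false = ℕP.≤-trans (s≤s (ℕP.m≤m+n p m)) (ℕP.≤-reflexive (sym (ℕP.+-suc p m)))

-- The count is started at the current tape position, so it always equals the position.
readUnary-decodes : ∀ t m p → p ℕ.≤ t → t ℕ.≤ p ℕ.+ m →
  proj₁ (runReader (readUnary p m) (unaryTape t) p) ≡ t
readUnary-decodes t zero    p p≤t t≤p+0 = ℕP.≤-antisym p≤t (subst (t ℕ.≤_) (ℕP.+-identityʳ p) t≤p+0)
readUnary-decodes t (suc m) p p≤t t≤p+1+m with p <ᵇ t in p<ᵇt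
... | true  = readUnary-decodes t m (suc p) (ℕP.<ᵇ⇒< p t (subst T (sym p<ᵇt) tt))
                (subst (t ℕ.≤_) (ℕP.+-suc p m) t≤p+1+m)
... | false = ℕP.≤-antisym p≤t (ℕP.≮⇒≥ (λ p<t → subst T p<ᵇt (ℕP.<⇒<ᵇ p<t)))

unaryAlgorithm : AdviceAlgorithm LengthGuessing
unaryAlgorithm = record { step = guess }
  where
  guess : Input → Item → List Bool → Reader ℕ
  guess []      a _ = readUnary 0 (length a)
  guess (_ ∷ _) _ _ = done 0

unaryAdvice : Input → Tape
unaryAdvice (_ ∷ b ∷ _) = unaryTape (length b)
unaryAdvice _           = unaryTape 0

unaryAlgorithm-later-steps-read-nothing : ∀ φ a prev p xs →
  proj₂ (process unaryAlgorithm φ (a ∷ prev) p xs) ≡ p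
unaryAlgorithm-later-steps-read-nothing φ a prev p []       = refl
unaryAlgorithm-later-steps-read-nothing φ a prev p (x ∷ xs) =
  unaryAlgorithm-later-steps-read-nothing φ a (prev ++ [ x ]) p xs

unaryAlgorithm-bitsRead≤ : ∀ φ I → bitsRead unaryAlgorithm φ I ℕ.≤ maxItemBits I
unaryAlgorithm-bitsRead≤ φ []         = z≤n
unaryAlgorithm-bitsRead≤ φ (a ∷ rest) = begin
  bitsRead unaryAlgorithm φ (a ∷ rest)
    ≡⟨ unaryAlgorithm-later-steps-read-nothing φ a [] _ rest ⟩
  proj₂ (runReader (readUnary 0 (length a)) φ 0)
    ≤⟨ readUnary-reads≤ φ 0 (length a) 0 ⟩
  length a
    ≤⟨ ℕP.m≤m⊔n (length a) (maxItemBits rest) ⟩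
  maxItemBits (a ∷ rest) ∎
  where open ℕP.≤-Reasoning

unaryAlgorithm-optimal : ∀ I y →
  guessValue I y ≤ guessValue I (runAlg unaryAlgorithm (unaryAdvice I) I)
unaryAlgorithm-optimal []          y = ℚP.≤-refl
unaryAlgorithm-optimal (_ ∷ [])    y = ℚP.≤-refl
unaryAlgorithm-optimal (a ∷ b ∷ rest) y = byLengths (length b ℕP.≤? length a)
  where
  open ℚP.≤-Reasoning
  I = a ∷ b ∷ rest
  byLengths : Dec (length b ℕ.≤ length a) →
    guessValue I y ≤ guessValue I (runAlg unaryAlgorithm (unaryAdvice I) I)
  byLengths (yes b≤a) = begin
    guessValue I y               ≤⟨ guessValue≤fromℕ a b rest y ⟩
    fromℕ (length a)                    ≡⟨ sym (guessValue-hit a b rest laterGuesses b≤a) ⟩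
    guessValue I (length b ∷ laterGuesses) ≡⟨ cong (λ o → guessValue I (o ∷ laterGuesses)) (sym firstGuess≡b) ⟩
    guessValue I (runAlg unaryAlgorithm (unaryAdvice I) I) ∎
    where
    firstGuess = runReader (readUnary 0 (length a)) (unaryTape (length b)) 0
    laterGuesses = proj₁ (process unaryAlgorithm (unaryTape (length b)) [ a ] (proj₂ firstGuess) (b ∷ rest))
    firstGuess≡b : proj₁ firstGuess ≡ length b
    firstGuess≡b = readUnary-decodes (length b) (length a) 0 z≤n b≤a
  byLengths (no b≰a) = begin
    guessValue I y  ≡⟨ guessValue-tooLong a b rest y b≰a ⟩
    0ℚ              ≤⟨ 0≤guessValue I (runAlg unaryAlgorithm (unaryAdvice I) I) ⟩
    guessValue I (runAlg unaryAlgorithm (unaryAdvice I) I) ∎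

lengthGuessing-∈-WEAC : InWEAC LengthGuessing
lengthGuessing-∈-WEAC ε 0<ε = 1 , 1 , unaryAlgorithm , 0ℚ , λ I → unaryAdvice I ,
  ℕP.≤-trans (unaryAlgorithm-bitsRead≤ (unaryAdvice I) I) (s≤poly (size I) (maxItemBits I)) ,
  tt ,
  λ y _ → ℚP.≤-trans (unaryAlgorithm-optimal I y)
                     (≤-scaleUp (ℚP.<⇒≤ 0<ε) (0≤guessValue I (runAlg unaryAlgorithm (unaryAdvice I) I)))
  where
  s≤poly : ∀ n s → s ℕ.≤ 1 ℕ.* ((1 ℕ.+ ⌊log₂ n ⌋ ℕ.+ s) ^ 1)
  s≤poly n s = subst (s ℕ.≤_) (sym (trans (ℕP.*-identityˡ _) (ℕP.^-identityʳ _)))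
                     (ℕP.m≤n+m s (1 ℕ.+ ⌊log₂ n ⌋))

lengthGuessing-needs-growing-advice : ∀ {c b} B → (∀ s → b 2 s ℕ.≤ B) →
  ¬ AchievesWithAdvice LengthGuessing c b
lengthGuessing-needs-growing-advice {c} B bounded (A , α , oracle) =
  contradiction (cover⇒<length guessesEveryLength) (ℕP.≤⇒≯ tooFewGuesses)
  where
  L = suc (2 ^ B ℕ.+ ℤ.∣ ↥ α ∣)
  a = replicate L true
  firstStep = step A [] a []

  tooFewGuesses : length (outcomes firstStep B) ℕ.≤ L
  tooFewGuesses = ℕP.m≤n⇒m≤1+n (ℕP.≤-trans (length-outcomes firstStep B) (ℕP.m≤m+n (2 ^ B) _))

  guessesLengthOf : ∀ b → length b ℕ.≤ length a → length b ∈ outcomes firstStep B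
  guessesLengthOf b b≤a with oracle (a ∷ b ∷ [])
  ... | φ , bits , _ , competitive =
    subst (_∈ outcomes firstStep B) (firstGuess≡b (proj₁ firstGuess ℕP.≟ length b))
          (runReader-∈-outcomes firstStep φ 0 B readsFew)
    where
    I = a ∷ b ∷ []
    firstGuess = runReader firstStep φ 0
    laterGuesses = proj₁ (process A φ [ a ] (proj₂ firstGuess) [ b ])

    readsFew : proj₂ firstGuess ℕ.≤ B
    readsFew = ℕP.≤-trans (process-advances A φ [ a ] (proj₂ firstGuess) [ b ])
                          (ℕP.≤-trans bits (bounded _))

    L≤∣↥α∣ : proj₁ firstGuess ≢ length b → L ℕ.≤ ℤ.∣ ↥ α ∣
    L≤∣↥α∣ wrong = subst (ℕ._≤ ℤ.∣ ↥ α ∣) (ListP.length-replicate L) (fromℕ≤⇒≤∣↥∣ α (begin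
      fromℕ (length a)                              ≡⟨ sym (guessValue-hit a b [] [] b≤a) ⟩
      guessValue I (length b ∷ [])                  ≤⟨ competitive (length b ∷ []) tt ⟩
      c * guessValue I (runAlg A φ I) + α           ≡⟨ cong (λ v → c * v + α)
                                                         (guessValue-miss a b [] (proj₁ firstGuess) laterGuesses wrong) ⟩
      c * 0ℚ + α                                    ≡⟨ cong (_+ α) (ℚP.*-zeroʳ c) ⟩
      0ℚ + α                                        ≡⟨ ℚP.+-identityˡ α ⟩
      α                                             ∎))
      where open ℚP.≤-Reasoning

    firstGuess≡b : Dec (proj₁ firstGuess ≡ length b) → proj₁ firstGuess ≡ length b
    firstGuess≡b (yes right) = right
    firstGuess≡b (no wrong)  = contradiction (L≤∣↥α∣ wrong) (ℕP.<⇒≱ (s≤s (ℕP.m≤n+m _ (2 ^ B))))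

  guessesEveryLength : ∀ t → t ℕ.≤ L → t ∈ outcomes firstStep B
  guessesEveryLength t t≤L =
    subst (_∈ outcomes firstStep B) (ListP.length-replicate t)
          (guessesLengthOf (replicate t true)
            (subst₂ ℕ._≤_ (sym (ListP.length-replicate t)) (sym (ListP.length-replicate L)) t≤L))

lengthGuessing-∉-EAC : ¬ InEAC LengthGuessing
lengthGuessing-∉-EAC eac with eac 1ℚ (ℚP.positive⁻¹ 1ℚ)
... | C , k , achieves =
  lengthGuessing-needs-growing-advice {1ℚ + 1ℚ} {λ n _ → polylog n} (polylog 2) (λ _ → ℕP.≤-refl) achieves
  where
  polylog : ℕ → ℕ
  polylog n = C ℕ.* ((1 ℕ.+ ⌊log₂ n ⌋) ^ k)

mainTheorem4 : Σ OnlineProblem (λ P → InWEAC P × ¬ InEAC P)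
mainTheorem4 = LengthGuessing , lengthGuessing-∈-WEAC , lengthGuessing-∉-EAC
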